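{- For each $n$, let $k(n)$ be a positive integer with $k(n)\le n$, and let $B(n,k(n))$ be the graph of order $n$ which is the disjoint union of $k(n)$ complete balanced bipartite graphs, each of order $\lfloor n/k(n)\rfloor$ or $\lceil n/k(n)\rceil$. If $k(n) = O(n/\log_2 n)$, then \[ \lim_{n\to\infty}\frac{1}{n}\log_2 F(B(n,k(n))) = 1. \]
   Context: A complete balanced bipartite graph of order $m$ is $K_{\lfloor m/2\rfloor,\lceil m/2\rceil}$. For a finite graph $G$, a permutation of the vertices of $G$ is a sequence listing every vertex of $G$ exactly once; two such permutations $\pi,\sigma$ are $G$-different if there is an index $i$ such that $\{\pi(i),\sigma(i)\}$ is an edge of $G$; $F(G)$ denotes the maximum size of a family of pairwise $G$-different permutations of the vertices of $G$. -}

module Defs where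

open import Data.Nat using (ℕ; zero; suc; _+_; _*_; _^_; _≤_; NonZero)
open import Data.Nat.DivMod using (_/_; _%_)
open import Data.Fin using (Fin; toℕ)
open import Data.Fin.Permutation using (Permutation′; _⟨$⟩ʳ_)
open import Data.Vec using (Vec; lookup)
open import Data.Product using (Σ; ∃; _×_)
open import Relation.Binary.PropositionalEquality using (_≡_; _≢_)

Graph : ℕ → Set₁
Graph n = Fin n → Fin n → Set

-- B(n,k): vertices 0..n-1; vertex v lies in block (v mod k) (round-robin,
-- so the k blocks have sizes ⌊n/k⌋ or ⌈n/k⌉), and inside its block on the
-- side ((v div k) mod 2) (alternating, so each block is split into halves of
-- sizes ⌊s/2⌋,⌈s/2⌉). So B n k is the
-- disjoint union of k complete balanced bipartite graphs K_{⌊s/2⌋,⌈s/2⌉}.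
B : (n k : ℕ) → .{{_ : NonZero k}} → Graph n
B n k u v = (toℕ u % k ≡ toℕ v % k) × ((toℕ u / k) % 2 ≢ (toℕ v / k) % 2)

GDifferent : ∀ {n} → Graph n → Permutation′ n → Permutation′ n → Set
GDifferent G π σ = ∃ λ i → G (π ⟨$⟩ʳ i) (σ ⟨$⟩ʳ i)

PairwiseDifferentFamily : ∀ {n} → Graph n → (f : ℕ) → Vec (Permutation′ n) f → Set
PairwiseDifferentFamily G f fam =
  ∀ (i j : Fin f) → i ≢ j → GDifferent G (lookup fam i) (lookup fam j)

module Submission where

-- A proper c-colouring of a graph on n vertices gives F ≤ c ^ n,
-- since G-different permutations have different colour words (pigeonhole);
-- B n k is properly 2-coloured by sides, so F ≤ 2 ^ n.
--
-- If G contains q vertex-disjoint copies of K_{a,b}, then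
-- F(G) ≥ (a+b choose a) ^ q: rearrange every copy independently by a shuffle
-- of its a + b positions into its two sides, and note that distinct shuffles
-- send some position to opposite sides.  B n k contains (n / 2tk) · k copies
-- of K_{t,t}, and (2t choose t) ≥ 4 ^ t / (2t + 1).  With t = 2 ^ (4m) and
-- k(n) · 4tm ≤ n for large n, this gives F ^ m ≥ 2 ^ (n (m - 1)).

open import Defs
open import Data.Nat using (ℕ; zero; suc; _+_; _*_; _^_; _∸_; _≤_; NonZero)
open import Data.Nat.Logarithm using (⌊log₂_⌋)
open import Data.Fin.Permutation using (Permutation′)
open import Data.Vec using (Vec)
open import Data.Product using (Σ; ∃; _×_; _,_; proj₁; proj₂)

open import Data.Bool using (Bool; true; false)
open import Data.Empty using (⊥-elim)
open import Data.Fin using (Fin; zero; suc; toℕ; _↑ˡ_; splitAt; join; combine; quotient; remainder; finToFun; funToFin)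
open import Data.Fin.Permutation using (_⟨$⟩ʳ_; cast-id)
open import Data.Fin.Properties using (+↔⊎; *↔×; splitAt⁻¹-↑ˡ; splitAt⁻¹-↑ʳ; join-splitAt; remQuot-combine; combine-remQuot; funToFin-finToFin; finToFun-funToFin; toℕ-cast; toℕ-↑ˡ; toℕ-combine; toℕ-fromℕ<; toℕ<n; toℕ-injective; ¬∀⟶∃¬; _≟_; pigeonhole; <⇒≢)
open import Data.Nat.DivMod using (_/_; _%_; _mod_; m≡m%n+[m/n]*n; m%n<n; [m+kn]%n≡m%n; m<n⇒m%n≡m; +-distrib-/-∣ʳ; m<n⇒m/n≡0; m*n/n≡m)
open import Data.Nat.Divisibility using (divides-refl)
open import Data.Nat.Logarithm using (⌊log₂⌋-mono-≤; ⌊log₂[2^n]⌋≡n)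
open import Data.Nat.Properties using (_≤?_; ≰⇒>; suc-injective; ≤-refl; ≤-trans; <⇒≤; n≤1+n; m≤m+n; m≤n+m; +-suc; +-comm; +-assoc; +-identityʳ; *-comm; *-assoc; *-identityʳ; *-identityˡ; *-distribʳ-+; *-distribˡ-+; +-mono-≤; +-monoˡ-≤; +-monoʳ-≤; *-mono-≤; *-monoˡ-≤; *-monoʳ-≤; +-cancelʳ-≤; *-cancelʳ-≤; *-cancelˡ-≤; m*n≢0; m^n>0; m^n≢0; ^-distribˡ-+-*; ^-*-assoc; ^-monoʳ-≤; ^-monoˡ-≤; module ≤-Reasoning)
open import Data.Nat.Tactic.RingSolver using (solve-∀)
open import Data.Product.Function.NonDependent.Propositional using (_×-↔_)
open import Data.Sum using (_⊎_; inj₁; inj₂; [_,_]′)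
open import Data.Sum.Algebra using (⊎-assoc; ⊎-comm)
open import Data.Sum.Function.Propositional using (_⊎-↔_)
open import Data.Vec using (lookup; tabulate)
open import Data.Vec.Properties using (lookup∘tabulate)
open import Function.Base using (const; id)
open import Function.Bundles using (_↔_; Inverse; mk↔ₛ′)
open import Function.Construct.Composition using (_↔-∘_)
open import Function.Construct.Identity using (↔-id)
open import Function.Construct.Symmetry using (↔-sym)
open import Level using (0ℓ)
open import Relation.Binary.PropositionalEquality
open import Relation.Nullary using (yes; no)
open Inverse using (to; from; strictlyInverseˡ; strictlyInverseʳ)

isRight : ∀ {A B : Set} → A ⊎ B → Bool
isRight = [ const false , const true ]′

Separated : ∀ {P A B : Set} → (P → A ⊎ B) → (P → A ⊎ B) → Set
Separated σ τ = ∃ λ p → isRight (σ p) ≢ isRight (τ p)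

-- Prepending a position labelled by a new left element:
-- Fin (1 + L) ≅ Fin 1 ⊎ Fin L ≅ Fin 1 ⊎ (Fin a ⊎ Fin b) ≅ Fin (1 + a) ⊎ Fin b.
consˡ : ∀ {L a b} → Fin L ↔ (Fin a ⊎ Fin b) → Fin (suc L) ↔ (Fin (suc a) ⊎ Fin b)
consˡ {L} {a} {b} β =
  (↔-sym (+↔⊎ {1} {a}) ⊎-↔ ↔-id (Fin b))
    ↔-∘ (↔-sym (⊎-assoc 0ℓ (Fin 1) (Fin a) (Fin b))
    ↔-∘ ((↔-id (Fin 1) ⊎-↔ β) ↔-∘ +↔⊎ {1} {L}))

consʳ : ∀ {L a b} → Fin L ↔ (Fin a ⊎ Fin b) → Fin (suc L) ↔ (Fin a ⊎ Fin (suc b))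
consʳ {a = a} {b} β = ⊎-comm (Fin (suc b)) (Fin a) ↔-∘ consˡ (⊎-comm (Fin a) (Fin b) ↔-∘ β)

consˡ-isRight : ∀ {L a b} (β : Fin L ↔ (Fin a ⊎ Fin b)) p →
                isRight (to (consˡ β) (suc p)) ≡ isRight (to β p)
consˡ-isRight β p with to β p
... | inj₁ _ = refl
... | inj₂ _ = refl

consʳ-isRight : ∀ {L a b} (β : Fin L ↔ (Fin a ⊎ Fin b)) p →
                isRight (to (consʳ β) (suc p)) ≡ isRight (to β p)
consʳ-isRight β p with to β p
... | inj₁ _ = refl
... | inj₂ _ = refl

-- The number of (a,b)-shuffles, i.e. the binomial coefficient (a+b choose a),
-- given by Pascal's recurrence.
shuffles : ℕ → ℕ → ℕ
shuffles zero b = 1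
shuffles (suc a) zero = 1
shuffles (suc a) (suc b) = shuffles a (suc b) + shuffles (suc a) b

-- The shuffles themselves: labellings of L = a + b positions by a left and
-- b right elements, enumerated by the first position's half and recursion.
shuffle : ∀ a b {L} → L ≡ a + b → Fin (shuffles a b) → Fin L ↔ (Fin a ⊎ Fin b)
shuffle zero b refl _ = +↔⊎
shuffle (suc a) zero refl _ = +↔⊎
shuffle (suc a) (suc b) {suc L} eq i =
  [ (λ i₀ → consˡ (shuffle a (suc b) (suc-injective eq) i₀))
  , (λ i₁ → consʳ (shuffle (suc a) b (trans (suc-injective eq) (+-suc a b)) i₁))
  ]′ (splitAt (shuffles a (suc b)) i)

shuffle-separated : ∀ a b {L} (eq : L ≡ a + b) {i j} → i ≢ j →
                    Separated (to (shuffle a b eq i)) (to (shuffle a b eq j))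
shuffle-separated zero b refl {zero} {zero} i≢j = ⊥-elim (i≢j refl)
shuffle-separated (suc a) zero refl {zero} {zero} i≢j = ⊥-elim (i≢j refl)
shuffle-separated (suc a) (suc b) {suc L} eq {i} {j} i≢j
  with splitAt (shuffles a (suc b)) i in si | splitAt (shuffles a (suc b)) j in sj
... | inj₁ _ | inj₂ _ = zero , λ ()
... | inj₂ _ | inj₁ _ = zero , λ ()
... | inj₁ i₀ | inj₁ j₀ =
  let σ = shuffle a (suc b) (suc-injective eq)
      p , d = shuffle-separated a (suc b) (suc-injective eq) {i₀} {j₀}
                (λ { refl → i≢j (trans (sym (splitAt⁻¹-↑ˡ si)) (splitAt⁻¹-↑ˡ sj)) })
  in suc p , λ e → d (trans (sym (consˡ-isRight (σ i₀) p)) (trans e (consˡ-isRight (σ j₀) p)))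
... | inj₂ i₁ | inj₂ j₁ =
  let σ = shuffle (suc a) b (trans (suc-injective eq) (+-suc a b))
      p , d = shuffle-separated (suc a) b (trans (suc-injective eq) (+-suc a b)) {i₁} {j₁}
                (λ { refl → i≢j (trans (sym (splitAt⁻¹-↑ʳ si)) (splitAt⁻¹-↑ʳ sj)) })
  in suc p , λ e → d (trans (sym (consʳ-isRight (σ i₁) p)) (trans e (consʳ-isRight (σ j₁) p)))

shuffles-sym : ∀ a b → shuffles a b ≡ shuffles b a
shuffles-sym zero zero = refl
shuffles-sym zero (suc b) = refl
shuffles-sym (suc a) zero = refl
shuffles-sym (suc a) (suc b) =
  trans (cong₂ _+_ (shuffles-sym a (suc b)) (shuffles-sym (suc a) b))
        (+-comm (shuffles (suc b) a) (shuffles b (suc a)))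

shuffles-one : ∀ a → shuffles a 1 ≡ suc a
shuffles-one zero = refl
shuffles-one (suc a) = trans (+-comm (shuffles a 1) 1) (cong suc (shuffles-one a))

shuffles-absorb : ∀ a b → shuffles a (suc b) * suc b ≡ shuffles a b * suc (a + b)
shuffles-absorb zero b = refl
shuffles-absorb (suc a) zero = begin
  shuffles (suc a) 1 * 1     ≡⟨ *-identityʳ _ ⟩
  shuffles (suc a) 1         ≡⟨ shuffles-one (suc a) ⟩
  suc (suc a)                ≡⟨ cong (λ x → suc (suc x)) (+-identityʳ a) ⟨
  suc (suc a + 0)            ≡⟨ *-identityˡ _ ⟨
  1 * suc (suc a + 0)        ∎
  where open ≡-Reasoning
shuffles-absorb (suc a) (suc b) = begin
  (u′ + v′) * suc (suc b)                              ≡⟨ regroup₁ u′ v′ (suc b) ⟩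
  u′ * suc (suc b) + v′ * suc b + v′                   ≡⟨ cong₂ (λ x y → x + y + v′) (shuffles-absorb a (suc b)) (shuffles-absorb (suc a) b) ⟩
  u * suc (a + suc b) + v * suc (suc a + b) + v′       ≡⟨ cong (λ x → u * suc x + v * suc (suc a + b) + v′) (+-suc a b) ⟩
  u * suc (suc a + b) + v * suc (suc a + b) + (u + v)  ≡⟨ regroup₂ u v (suc a + b) ⟩
  (u + v) * suc (suc (suc a + b))                      ≡⟨ cong (λ x → (u + v) * suc x) (+-suc (suc a) b) ⟨
  (u + v) * suc (suc a + suc b)                        ∎
  where
  open ≡-Reasoning
  u = shuffles a (suc b)
  v = shuffles (suc a) b
  u′ = shuffles a (suc (suc b))
  v′ = shuffles (suc a) (suc b)
  regroup₁ : ∀ x y z → (x + y) * suc z ≡ x * suc z + y * z + y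
  regroup₁ = solve-∀
  regroup₂ : ∀ x y z → x * suc z + y * suc z + (x + y) ≡ (x + y) * suc (suc z)
  regroup₂ = solve-∀

shuffles-central-step : ∀ t → shuffles (suc t) (suc t) * suc t ≡ 2 * suc (t + t) * shuffles t t
shuffles-central-step t = begin
  (shuffles t (suc t) + shuffles (suc t) t) * suc t  ≡⟨ cong (λ x → (shuffles t (suc t) + x) * suc t) (shuffles-sym (suc t) t) ⟩
  (shuffles t (suc t) + shuffles t (suc t)) * suc t  ≡⟨ *-distribʳ-+ (suc t) (shuffles t (suc t)) _ ⟩
  shuffles t (suc t) * suc t + shuffles t (suc t) * suc t ≡⟨ cong₂ _+_ (shuffles-absorb t t) (shuffles-absorb t t) ⟩
  shuffles t t * suc (t + t) + shuffles t t * suc (t + t) ≡⟨ double (shuffles t t) (suc (t + t)) ⟩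
  2 * suc (t + t) * shuffles t t                      ∎
  where
  open ≡-Reasoning
  double : ∀ x y → x * y + x * y ≡ 2 * y * x
  double = solve-∀

shuffles-central-bound : ∀ t → 4 ^ t ≤ shuffles t t * suc (t + t)
shuffles-central-bound zero = ≤-refl
shuffles-central-bound (suc t) = *-cancelʳ-≤ (4 ^ suc t) (shuffles (suc t) (suc t) * suc (suc t + suc t)) (suc t) (begin
  4 * 4 ^ t * suc t                              ≤⟨ *-monoˡ-≤ (suc t) (*-monoʳ-≤ 4 (shuffles-central-bound t)) ⟩
  4 * (c * suc (t + t)) * suc t                  ≤⟨ step c t ⟩
  2 * suc (t + t) * c * suc (suc t + suc t)      ≡⟨ cong (_* suc (suc t + suc t)) (shuffles-central-step t) ⟨
  c′ * suc t * suc (suc t + suc t)               ≡⟨ swap c′ (suc t) (suc (suc t + suc t)) ⟩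
  c′ * suc (suc t + suc t) * suc t               ∎)
  where
  open ≤-Reasoning
  c = shuffles t t
  c′ = shuffles (suc t) (suc t)
  swap : ∀ x y z → x * y * z ≡ x * z * y
  swap = solve-∀
  -- 4 (t + 1) ≤ 2 (2t + 3)
  step : ∀ c t → 4 * (c * suc (t + t)) * suc t ≤ 2 * suc (t + t) * c * suc (suc t + suc t)
  step c t = subst (4 * (c * suc (t + t)) * suc t ≤_) (expand c t) (m≤m+n _ (2 * suc (t + t) * c))
    where
    expand : ∀ c t → 4 * (c * suc (t + t)) * suc t + 2 * suc (t + t) * c ≡ 2 * suc (t + t) * c * suc (suc t + suc t)
    expand = solve-∀

funToFin-cong : ∀ {m n} {f g : Fin m → Fin n} → (∀ x → f x ≡ g x) → funToFin f ≡ funToFin g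
funToFin-cong {zero} f≗g = refl
funToFin-cong {suc m} f≗g = cong₂ combine (f≗g zero) (funToFin-cong (λ x → f≗g (suc x)))

finToFun-separates : ∀ {m n} {i j : Fin (n ^ m)} → i ≢ j → ∃ λ x → finToFun i x ≢ finToFun j x
finToFun-separates {m} {n} {i} {j} i≢j =
  ¬∀⟶∃¬ m _ (λ x → finToFun i x ≟ finToFun j x) λ same →
    i≢j (begin
      i                             ≡⟨ funToFin-finToFin {m} {n} i ⟨
      funToFin (finToFun {n} {m} i) ≡⟨ funToFin-cong same ⟩
      funToFin (finToFun {n} {m} j) ≡⟨ funToFin-finToFin {m} {n} j ⟩
      j                             ∎)
  where open ≡-Reasoning

ProperColouring : ∀ {n} → Graph n → (c : ℕ) → (Fin n → Fin c) → Set
ProperColouring G c colour = ∀ {u v} → G u v → colour u ≢ colour v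

colourCode : ∀ {n c} → (Fin n → Fin c) → Permutation′ n → Fin (c ^ n)
colourCode colour π = funToFin (λ p → colour (π ⟨$⟩ʳ p))

colourCode-determines : ∀ {n c} (colour : Fin n → Fin c) (π σ : Permutation′ n) →
                        colourCode colour π ≡ colourCode colour σ →
                        ∀ p → colour (π ⟨$⟩ʳ p) ≡ colour (σ ⟨$⟩ʳ p)
colourCode-determines colour π σ same p = begin
  colour (π ⟨$⟩ʳ p)                         ≡⟨ finToFun-funToFin (λ q → colour (π ⟨$⟩ʳ q)) p ⟨
  finToFun (colourCode colour π) p          ≡⟨ cong (λ w → finToFun w p) same ⟩
  finToFun (colourCode colour σ) p          ≡⟨ finToFun-funToFin (λ q → colour (σ ⟨$⟩ʳ q)) p ⟩
  colour (σ ⟨$⟩ʳ p)                         ∎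
  where open ≡-Reasoning

-- Upper bound F(G) ≤ c ^ n for a c-coloured graph on n vertices: G-different
-- permutations have different colour codes, so by pigeonhole a family has at
-- most c ^ n members.
family-bound : ∀ {n c} (G : Graph n) (colour : Fin n → Fin c) → ProperColouring G c colour →
               ∀ f (fam : Vec (Permutation′ n) f) → PairwiseDifferentFamily G f fam → f ≤ c ^ n
family-bound {n} {c} G colour proper f fam different with f ≤? c ^ n
... | yes f≤cⁿ = f≤cⁿ
... | no f≰cⁿ with pigeonhole (≰⇒> f≰cⁿ) (λ a → colourCode colour (lookup fam a))
... | i , j , i<j , same with different i j (<⇒≢ i<j)
... | p , edge = ⊥-elim (proper edge (colourCode-determines colour (lookup fam i) (lookup fam j) same p))

-- q vertex-disjoint copies of the complete bipartite graph K_{a,b} in G,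
-- presented as a relabelling of the vertices: (g , x) is the vertex x of the
-- g-th copy, lying on side isRight x; the other vertices are labelled by Fin rest.
record Packing {n} (G : Graph n) (q a b : ℕ) : Set where
  field
    rest     : ℕ
    layout   : Fin n ↔ ((Fin q × (Fin a ⊎ Fin b)) ⊎ Fin rest)
    complete : ∀ g x y → isRight x ≢ isRight y →
               G (from layout (inj₁ (g , x))) (from layout (inj₁ (g , y)))

fibrewise : ∀ {I E : Set} → (I → E ↔ E) → (I × E) ↔ (I × E)
fibrewise ρ = mk↔ₛ′
  (λ { (g , e) → g , to (ρ g) e }) (λ { (g , e) → g , from (ρ g) e })
  (λ { (g , e) → cong (g ,_) (strictlyInverseˡ (ρ g) e) })
  (λ { (g , e) → cong (g ,_) (strictlyInverseʳ (ρ g) e) })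

module _ {n} {G : Graph n} {q a b} (P : Packing G q a b) where
  open Packing P

  reshuffle : (Fin q → Fin (shuffles a b)) → Fin q → (Fin a ⊎ Fin b) ↔ (Fin a ⊎ Fin b)
  reshuffle choice g = shuffle a b refl (choice g) ↔-∘ ↔-sym +↔⊎

  rearrange : (Fin q → Fin (shuffles a b)) → Permutation′ n
  rearrange choice =
    ↔-sym layout ↔-∘ ((fibrewise (reshuffle choice) ⊎-↔ ↔-id (Fin rest)) ↔-∘ layout)

  rearrange-copy : ∀ choice g x →
                   rearrange choice ⟨$⟩ʳ from layout (inj₁ (g , x))
                     ≡ from layout (inj₁ (g , to (shuffle a b refl (choice g)) (join a b x)))
  rearrange-copy choice g x =
    cong (λ y → from layout (to (fibrewise (reshuffle choice) ⊎-↔ ↔-id (Fin rest)) y)) (strictlyInverseˡ layout _)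

  -- If two choices differ on copy g, their shuffles separate some position of
  -- that copy, and the vertex there is sent to opposite sides of copy g.
  rearrange-different : ∀ choice choice′ g → choice g ≢ choice′ g →
                        GDifferent G (rearrange choice) (rearrange choice′)
  rearrange-different choice choice′ g differ =
    let p , separated = shuffle-separated a b refl differ
        at : ∀ c → rearrange c ⟨$⟩ʳ from layout (inj₁ (g , splitAt a p))
                     ≡ from layout (inj₁ (g , to (shuffle a b refl (c g)) p))
        at c = trans (rearrange-copy c g (splitAt a p))
                     (cong (λ y → from layout (inj₁ (g , to (shuffle a b refl (c g)) y))) (join-splitAt a b p))
    in from layout (inj₁ (g , splitAt a p)) ,
       subst₂ G (sym (at choice)) (sym (at choice′)) (complete g _ _ separated)

  packing-family : Σ (Vec (Permutation′ n) (shuffles a b ^ q)) (PairwiseDifferentFamily G (shuffles a b ^ q))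
  packing-family = fam , different
    where
    fam : Vec (Permutation′ n) (shuffles a b ^ q)
    fam = tabulate (λ idx → rearrange (finToFun idx))
    different : PairwiseDifferentFamily G (shuffles a b ^ q) fam
    different i j i≢j =
      let g , differ = finToFun-separates i≢j
      in subst₂ (GDifferent G) (sym (lookup∘tabulate _ i)) (sym (lookup∘tabulate _ j))
                (rearrange-different (finToFun i) (finToFun j) g differ)

n<2^n : ∀ a → suc a ≤ 2 ^ a
n<2^n zero = ≤-refl
n<2^n (suc a) = begin
  1 + suc a              ≤⟨ +-mono-≤ (m^n>0 2 a) (n<2^n a) ⟩
  2 ^ a + 2 ^ a          ≡⟨ cong (2 ^ a +_) (+-identityʳ (2 ^ a)) ⟨
  2 ^ suc a              ∎
  where open ≤-Reasoning

-- (4m + 2) · m ≤ 2 ^ (4m), since (4m + 2) · m < (2m + 1)² ≤ (2 ^ (2m))².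
linear-below-exponential : ∀ m → (2 + 4 * m) * m ≤ 2 ^ (4 * m)
linear-below-exponential m = begin
  (2 + 4 * m) * m                       ≤⟨ m≤m+n _ (2 * m + 1) ⟩
  (2 + 4 * m) * m + (2 * m + 1)         ≡⟨ square m ⟩
  suc (2 * m) * suc (2 * m)             ≤⟨ *-mono-≤ (n<2^n (2 * m)) (n<2^n (2 * m)) ⟩
  2 ^ (2 * m) * 2 ^ (2 * m)             ≡⟨ ^-distribˡ-+-* 2 (2 * m) (2 * m) ⟨
  2 ^ (2 * m + 2 * m)                   ≡⟨ cong (2 ^_) (double m) ⟩
  2 ^ (4 * m)                           ∎
  where
  open ≤-Reasoning
  square : ∀ m → (2 + 4 * m) * m + (2 * m + 1) ≡ suc (2 * m) * suc (2 * m)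
  square = solve-∀
  double : ∀ m → 2 * m + 2 * m ≡ 4 * m
  double = solve-∀

-- For every m there is a copy size t whose central binomial coefficient loses
-- only h bits against 4 ^ t, with h · m ≤ t: take t = 2 ^ (4m), h = 4m + 2.
copy-size : ∀ m → ∃ λ t → ∃ λ h → NonZero t × 4 ^ t ≤ shuffles t t * 2 ^ h × h * m ≤ t
copy-size m = t , 2 + 4 * m , m^n≢0 2 (4 * m) , central , linear-below-exponential m
  where
  t = 2 ^ (4 * m)
  central : 4 ^ t ≤ shuffles t t * 2 ^ (2 + 4 * m)
  central = ≤-trans (shuffles-central-bound t) (*-monoʳ-≤ (shuffles t t) (begin
    suc (t + t)           ≤⟨ +-monoˡ-≤ (t + t) (≤-trans (m^n>0 2 (4 * m)) (m≤m+n t t)) ⟩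
    t + t + (t + t)       ≡⟨ quadruple t ⟩
    2 * (2 * t)           ∎))
    where
    open ≤-Reasoning
    quadruple : ∀ t → t + t + (t + t) ≡ 2 * (2 * t)
    quadruple = solve-∀

*-^-distrib : ∀ a b e → (a * b) ^ e ≡ a ^ e * b ^ e
*-^-distrib a b zero = refl
*-^-distrib a b (suc e) = trans (cong (a * b *_) (*-^-distrib a b e)) (interchange a b (a ^ e) (b ^ e))
  where
  interchange : ∀ a b x y → a * b * (x * y) ≡ a * x * (b * y)
  interchange = solve-∀

power-bound : ∀ {t c h} x e → 4 ^ t ≤ c * 2 ^ h → x + h * e ≤ 2 * (t * e) → 2 ^ x ≤ c ^ e
power-bound {t} {c} {h} x e central exponents =
  *-cancelʳ-≤ (2 ^ x) (c ^ e) (2 ^ (h * e)) {{m^n≢0 2 (h * e)}} (begin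
    2 ^ x * 2 ^ (h * e)       ≡⟨ ^-distribˡ-+-* 2 x (h * e) ⟨
    2 ^ (x + h * e)           ≤⟨ ^-monoʳ-≤ 2 exponents ⟩
    2 ^ (2 * (t * e))         ≡⟨ ^-*-assoc 2 2 (t * e) ⟨
    4 ^ (t * e)               ≡⟨ ^-*-assoc 4 t e ⟨
    (4 ^ t) ^ e               ≤⟨ ^-monoˡ-≤ e central ⟩
    (c * 2 ^ h) ^ e           ≡⟨ *-^-distrib c (2 ^ h) e ⟩
    c ^ e * (2 ^ h) ^ e       ≡⟨ cong (c ^ e *_) (^-*-assoc 2 h e) ⟩
    c ^ e * 2 ^ (h * e)       ∎)
  where open ≤-Reasoning

-- Losing one n out of n · m pays for two errors of size at most n / 2:
-- if n · m ≤ X · m + B with 2B ≤ n and 2A ≤ n, then n · (m - 1) + A ≤ X · m.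
absorb-errors : ∀ n X A B m′ → n * suc m′ ≤ X * suc m′ + B → 2 * A ≤ n → 2 * B ≤ n →
                n * m′ + A ≤ X * suc m′
absorb-errors n X A B m′ covered 2A≤n 2B≤n = +-cancelʳ-≤ n (n * m′ + A) (X * suc m′) (begin
  n * m′ + A + n            ≡⟨ unfold-suc n m′ A ⟩
  n * suc m′ + A            ≤⟨ +-monoˡ-≤ A covered ⟩
  X * suc m′ + B + A        ≡⟨ +-assoc (X * suc m′) B A ⟩
  X * suc m′ + (B + A)      ≤⟨ +-monoʳ-≤ (X * suc m′) B+A≤n ⟩
  X * suc m′ + n            ∎)
  where
  open ≤-Reasoning
  unfold-suc : ∀ n m′ A → n * m′ + A + n ≡ n * suc m′ + A
  unfold-suc = solve-∀
  B+A≤n : B + A ≤ n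
  B+A≤n = *-cancelˡ-≤ 2 (subst (_≤ 2 * n) (sym (*-distribˡ-+ 2 B A))
            (subst (2 * B + 2 * A ≤_) (sym (two-halves n)) (+-mono-≤ 2B≤n 2A≤n)))
    where
    two-halves : ∀ n → 2 * n ≡ n + n
    two-halves = solve-∀

digits : ∀ {a b c d} → Fin (a * b * c * d) ↔ (((Fin a × Fin b) × Fin c) × Fin d)
digits {a} {b} {c} {d} =
  ((*↔× ×-↔ ↔-id (Fin c)) ×-↔ ↔-id (Fin d)) ↔-∘ ((*↔× ×-↔ ↔-id (Fin d)) ↔-∘ *↔×)

-- combine w j is the number j + w · d, so j is its remainder and w its quotient.
toℕ-combine′ : ∀ {m d} (w : Fin m) (j : Fin d) → toℕ (combine w j) ≡ toℕ j + toℕ w * d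
toℕ-combine′ {d = d} w j =
  trans (toℕ-combine w j) (trans (+-comm (d * toℕ w) (toℕ j)) (cong (toℕ j +_) (*-comm d (toℕ w))))

combine-% : ∀ {m d} .{{_ : NonZero d}} (w : Fin m) (j : Fin d) → toℕ (combine w j) % d ≡ toℕ j
combine-% {d = d} w j = begin
  toℕ (combine w j) % d      ≡⟨ cong (_% d) (toℕ-combine′ w j) ⟩
  (toℕ j + toℕ w * d) % d    ≡⟨ [m+kn]%n≡m%n (toℕ j) (toℕ w) d ⟩
  toℕ j % d                  ≡⟨ m<n⇒m%n≡m (toℕ<n j) ⟩
  toℕ j                      ∎
  where open ≡-Reasoning

combine-/ : ∀ {m d} .{{_ : NonZero d}} (w : Fin m) (j : Fin d) → toℕ (combine w j) / d ≡ toℕ w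
combine-/ {d = d} w j = begin
  toℕ (combine w j) / d          ≡⟨ cong (_/ d) (toℕ-combine′ w j) ⟩
  (toℕ j + toℕ w * d) / d        ≡⟨ +-distrib-/-∣ʳ (toℕ j) (divides-refl (toℕ w)) ⟩
  toℕ j / d + toℕ w * d / d      ≡⟨ cong₂ _+_ (m<n⇒m/n≡0 (toℕ<n j)) (m*n/n≡m (toℕ w) d) ⟩
  toℕ w                          ∎
  where open ≡-Reasoning

sideDigit : ∀ {t} → Fin t ⊎ Fin t → Fin 2
sideDigit = [ const zero , const (suc zero) ]′

offset : ∀ {t} → Fin t ⊎ Fin t → Fin t
offset = [ id , id ]′

onSide : ∀ {t} → Fin 2 → Fin t → Fin t ⊎ Fin t
onSide zero = inj₁
onSide (suc zero) = inj₂

sideDigit-separates : ∀ {t} (x y : Fin t ⊎ Fin t) → isRight x ≢ isRight y → sideDigit x ≢ sideDigit y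
sideDigit-separates (inj₁ _) (inj₁ _) different = ⊥-elim (different refl)
sideDigit-separates (inj₁ _) (inj₂ _) different = λ ()
sideDigit-separates (inj₂ _) (inj₁ _) different = λ ()
sideDigit-separates (inj₂ _) (inj₂ _) different = ⊥-elim (different refl)

regroup : ∀ {R t k} → (((Fin R × Fin t) × Fin 2) × Fin k) ↔ (Fin (R * k) × (Fin t ⊎ Fin t))
regroup {R} {t} {k} = mk↔ₛ′ to′ from′ to∘from from∘to
  where
  to′ : ((Fin R × Fin t) × Fin 2) × Fin k → Fin (R * k) × (Fin t ⊎ Fin t)
  to′ (((r , o) , s) , j) = combine r j , onSide s o
  from′ : Fin (R * k) × (Fin t ⊎ Fin t) → ((Fin R × Fin t) × Fin 2) × Fin k
  from′ (g , x) = ((quotient k g , offset x) , sideDigit x) , remainder {R} k g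
  onSide-sideDigit : ∀ x → onSide (sideDigit x) (offset x) ≡ x
  onSide-sideDigit (inj₁ _) = refl
  onSide-sideDigit (inj₂ _) = refl
  to∘from : ∀ y → to′ (from′ y) ≡ y
  to∘from (g , x) = cong₂ _,_ (combine-remQuot {R} k g) (onSide-sideDigit x)
  offset-sideDigit : ∀ s o → (offset (onSide s o) , sideDigit (onSide s o)) ≡ (o , s)
  offset-sideDigit zero o = refl
  offset-sideDigit (suc zero) o = refl
  from∘to : ∀ y → from′ (to′ y) ≡ y
  from∘to (((r , o) , s) , j) =
    cong₂ (λ rj os → ((proj₁ rj , proj₁ os) , proj₂ os) , proj₂ rj)
          (remQuot-combine r j) (offset-sideDigit s o)

-- Cut the
-- vertex numbers into bands of 2tk consecutive numbers plus a remainder; a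
-- vertex of band r has digits (r, o, s, j) meaning j + k * (2 * (t * r + o) + s),
-- so it lies in block j on side s, and for fixed (r , j) these vertices
-- (o < t, s < 2) form a copy of K_{t,t}.
module _ (n k t : ℕ) .{{_ : NonZero k}} .{{_ : NonZero t}} where
  instance
    band≢0 : NonZero (t * 2 * k)
    band≢0 = m*n≢0 (t * 2) k {{m*n≢0 t 2}}

  bands : ℕ
  bands = n / (t * 2 * k)

  n≡bands+rest : n ≡ bands * t * 2 * k + n % (t * 2 * k)
  n≡bands+rest = begin
    n                                             ≡⟨ m≡m%n+[m/n]*n n (t * 2 * k) ⟩
    n % (t * 2 * k) + bands * (t * 2 * k)         ≡⟨ +-comm (n % (t * 2 * k)) _ ⟩
    bands * (t * 2 * k) + n % (t * 2 * k)         ≡⟨ cong (_+ n % (t * 2 * k)) (sym (*-assoc bands (t * 2) k)) ⟩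
    bands * (t * 2) * k + n % (t * 2 * k)         ≡⟨ cong (λ x → x * k + n % (t * 2 * k)) (sym (*-assoc bands t 2)) ⟩
    bands * t * 2 * k + n % (t * 2 * k)           ∎
    where open ≡-Reasoning

  bandLayout : Fin n ↔ ((Fin (bands * k) × (Fin t ⊎ Fin t)) ⊎ Fin (n % (t * 2 * k)))
  bandLayout =
    ((regroup {bands} {t} {k} ↔-∘ digits {bands} {t} {2} {k}) ⊎-↔ ↔-id (Fin (n % (t * 2 * k))))
      ↔-∘ (+↔⊎ ↔-∘ cast-id n≡bands+rest)

  band-packing : Packing (B n k) (bands * k) t t
  band-packing = record { rest = n % (t * 2 * k) ; layout = bandLayout ; complete = complete }
    where
    complete : ∀ g x y → isRight x ≢ isRight y →
               B n k (from bandLayout (inj₁ (g , x))) (from bandLayout (inj₁ (g , y)))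
    complete g x y different =
      trans (block x) (sym (block y)) ,
      λ same → sideDigit-separates x y different (toℕ-injective (trans (sym (side x)) (trans same (side y))))
      where
      vertex : Fin t ⊎ Fin t → Fin n
      vertex x = from bandLayout (inj₁ (g , x))
      j : Fin k
      j = remainder {bands} k g
      -- the vertex number divided by k, i.e. its digits (r, o, s)
      w : Fin t ⊎ Fin t → Fin (bands * t * 2)
      w x = combine (combine (quotient {bands} k g) (offset x)) (sideDigit x)
      toℕ-vertex : ∀ x → toℕ (vertex x) ≡ toℕ (combine (w x) j)
      toℕ-vertex x = trans (toℕ-cast (sym n≡bands+rest) (combine (w x) j ↑ˡ n % (t * 2 * k)))
                           (toℕ-↑ˡ (combine (w x) j) (n % (t * 2 * k)))
      block : ∀ x → toℕ (vertex x) % k ≡ toℕ j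
      block x = trans (cong (_% k) (toℕ-vertex x)) (combine-% (w x) j)
      side : ∀ x → (toℕ (vertex x) / k) % 2 ≡ toℕ (sideDigit x)
      side x = trans (cong (λ v → (v / k) % 2) (toℕ-vertex x))
                     (trans (cong (_% 2) (combine-/ (w x) j)) (combine-% (combine (quotient {bands} k g) (offset x)) (sideDigit x)))

  band-count-large : ∀ c h m′ → 4 ^ t ≤ c * 2 ^ h → h * suc m′ ≤ t → k * (4 * t * suc m′) ≤ n →
                      2 ^ (n * m′) ≤ (c ^ (bands * k)) ^ suc m′
  band-count-large c h m′ central hm≤t thin = begin
    2 ^ (n * m′)            ≤⟨ power-bound {t} {c} {h} (n * m′) e central exponents ⟩
    c ^ (bands * k * m)     ≡⟨ ^-*-assoc c (bands * k) m ⟨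
    (c ^ (bands * k)) ^ m   ∎
    where
    open ≤-Reasoning
    m = suc m′
    D = t * 2 * k
    X = bands * D
    e = bands * k * m
    n≡rest+X : n ≡ n % D + X
    n≡rest+X = m≡m%n+[m/n]*n n D
    covered : n * m ≤ X * m + D * m
    covered = subst (n * m ≤_) (*-distribʳ-+ m X D) (*-monoˡ-≤ m (begin
      n               ≡⟨ n≡rest+X ⟩
      n % D + X       ≤⟨ +-monoˡ-≤ X (<⇒≤ (m%n<n n D)) ⟩
      D + X           ≡⟨ +-comm D X ⟩
      X + D           ∎))
    thin′ : 2 * (D * m) ≤ n
    thin′ = subst (_≤ n) (reorder k t m) thin
      where
      reorder : ∀ k t m → k * (4 * t * m) ≡ 2 * (t * 2 * k * m)
      reorder = solve-∀
    loss : 2 * (h * e) ≤ n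
    loss = begin
      2 * (h * e)             ≡⟨ reorder₁ h bands k m ⟩
      2 * (bands * k) * (h * m) ≤⟨ *-monoʳ-≤ (2 * (bands * k)) hm≤t ⟩
      2 * (bands * k) * t     ≡⟨ reorder₂ bands k t ⟩
      X                       ≤⟨ m≤n+m X (n % D) ⟩
      n % D + X               ≡⟨ n≡rest+X ⟨
      n                       ∎
      where
      reorder₁ : ∀ h b k m → 2 * (h * (b * k * m)) ≡ 2 * (b * k) * (h * m)
      reorder₁ = solve-∀
      reorder₂ : ∀ b k t → 2 * (b * k) * t ≡ b * (t * 2 * k)
      reorder₂ = solve-∀
    exponents : n * m′ + h * e ≤ 2 * (t * e)
    exponents = subst (n * m′ + h * e ≤_) (reorder bands k t m)
                      (absorb-errors n X (h * e) (D * m) m′ covered loss thin′)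
      where
      reorder : ∀ b k t m → b * (t * 2 * k) * m ≡ 2 * (t * (b * k * m))
      reorder = solve-∀

  lower-bound : ∀ h m′ → 4 ^ t ≤ shuffles t t * 2 ^ h → h * suc m′ ≤ t → k * (4 * t * suc m′) ≤ n →
                ∃ λ f → ∃ λ (fam : Vec (Permutation′ n) f) →
                  PairwiseDifferentFamily (B n k) f fam × 2 ^ (n * m′) ≤ f ^ suc m′
  lower-bound h m′ central hm≤t thin =
    let fam , different = packing-family band-packing
    in _ , fam , different , band-count-large (shuffles t t) h m′ central hm≤t thin

sideColour : ∀ n k .{{_ : NonZero k}} → Fin n → Fin 2
sideColour n k v = (toℕ v / k) mod 2

sideColour-proper : ∀ n k .{{_ : NonZero k}} → ProperColouring (B n k) 2 (sideColour n k)
sideColour-proper n k {u} {v} (_ , sides≢) same =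
  sides≢ (trans (sym (toℕ-fromℕ< (m%n<n (toℕ u / k) 2)))
                (trans (cong toℕ same) (toℕ-fromℕ< (m%n<n (toℕ v / k) 2))))

-- k(n) = O(n / log₂ n) makes k(n) · Q ≤ n eventually, for every fixed Q: once
-- log₂ n ≥ Q · (C + 1), we get k(n) · Q · (C + 1) ≤ k(n) · log₂ n ≤ C · n.
thin-eventually : (k : ℕ → ℕ) → (∃ λ C → ∃ λ N₀ → ∀ n → N₀ ≤ n → k n * ⌊log₂ n ⌋ ≤ C * n) →
                  ∀ Q → ∃ λ N → ∀ n → N ≤ n → k n * Q ≤ n
thin-eventually k (C , N₀ , bound) Q = N₀ + 2 ^ (Q * suc C) , thin
  where
  thin : ∀ n → N₀ + 2 ^ (Q * suc C) ≤ n → k n * Q ≤ n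
  thin n N≤n = *-cancelʳ-≤ (k n * Q) n (suc C) (begin
    k n * Q * suc C     ≡⟨ *-assoc (k n) Q (suc C) ⟩
    k n * (Q * suc C)   ≤⟨ *-monoʳ-≤ (k n) log-large ⟩
    k n * ⌊log₂ n ⌋     ≤⟨ bound n (≤-trans (m≤m+n N₀ _) N≤n) ⟩
    C * n               ≤⟨ *-monoˡ-≤ n (n≤1+n C) ⟩
    suc C * n           ≡⟨ *-comm (suc C) n ⟩
    n * suc C           ∎)
    where
    open ≤-Reasoning
    log-large : Q * suc C ≤ ⌊log₂ n ⌋
    log-large = subst (_≤ ⌊log₂ n ⌋) (⌊log₂[2^n]⌋≡n (Q * suc C))
                      (⌊log₂⌋-mono-≤ (≤-trans (m≤n+m _ N₀) N≤n))

power-upper : ∀ {f n} m → f ≤ 2 ^ n → f ^ m ≤ 2 ^ (n * (m + 1))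
power-upper {f} {n} m f≤2ⁿ = begin
  f ^ m             ≤⟨ ^-monoˡ-≤ m f≤2ⁿ ⟩
  (2 ^ n) ^ m       ≡⟨ ^-*-assoc 2 n m ⟩
  2 ^ (n * m)       ≤⟨ ^-monoʳ-≤ 2 (*-monoʳ-≤ n (m≤m+n m 1)) ⟩
  2 ^ (n * (m + 1)) ∎
  where open ≤-Reasoning

upper-bound : ∀ n k .{{_ : NonZero k}} m → ∀ f (fam : Vec (Permutation′ n) f) →
              PairwiseDifferentFamily (B n k) f fam → f ^ m ≤ 2 ^ (n * (m + 1))
upper-bound n k m f fam different =
  power-upper {f} {n} m (family-bound (B n k) (sideColour n k) (sideColour-proper n k) f fam different)

-- Theorem: (1/n) log₂ F(B(n, k(n))) → 1, in the form: for every m ≥ 1,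
-- eventually F ^ m ≥ 2 ^ (n (m - 1)) (a packing family) and F ^ m ≤ 2 ^ (n (m + 1)).
theorem4 : (k : ℕ → ℕ) → (nz : ∀ n → NonZero (k n)) → (∀ n → 1 ≤ n → k n ≤ n)
    → (∃ λ C → ∃ λ N₀ → ∀ n → N₀ ≤ n → k n * ⌊log₂ n ⌋ ≤ C * n)
    → ∀ m → 1 ≤ m → ∃ λ N → ∀ n → N ≤ n →
    (∃ λ f → ∃ λ (fam : Vec (Permutation′ n) f) →
    PairwiseDifferentFamily (B n (k n) {{nz n}}) f fam × 2 ^ (n * (m ∸ 1)) ≤ f ^ m)
    × (∀ f → (fam : Vec (Permutation′ n) f) →
    PairwiseDifferentFamily (B n (k n) {{nz n}}) f fam → f ^ m ≤ 2 ^ (n * (m + 1)))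
theorem4 k nz _ growth (suc m′) _ with copy-size (suc m′)
... | t , h , t≢0 , central , hm≤t with thin-eventually k growth (4 * t * suc m′)
... | N , thin = N , λ n N≤n →
  lower-bound n (k n) t {{nz n}} {{t≢0}} h m′ central hm≤t (thin n N≤n) ,
  upper-bound n (k n) {{nz n}} (suc m′)
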